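{- Let $k$ be a positive integer. Every graph $G$ with maximum degree $\Delta(G)\leq\sqrt{k/2}$ admits an injective $k$-edge-coloring.
   Context: All graphs are finite and simple. An injective $k$-edge-coloring of a graph $G$ is a map $c: E(G)\to\{1,\dots,k\}$ such that for every path with three edges $e_1e_2e_3$ in $G$ (where the path may close up into a triangle), $c(e_1)\neq c(e_3)$. -}

module Defs where

open import Data.Nat using (ℕ; _*_; _≤_)
open import Data.Bool using (Bool; true; false; if_then_else_)
open import Data.Fin using (Fin)
open import Data.List using (List; map; allFin)
open import Data.Nat.ListAction using (sum)
open import Data.Product using (Σ)
open import Relation.Binary.PropositionalEquality using (_≡_; _≢_)

record Graph (n : ℕ) : Set where
  field
    adj     : Fin n → Fin n → Bool
    adj-sym : ∀ u v → adj u v ≡ adj v u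
    adj-irr : ∀ v → adj v v ≡ false

open Graph public

Adj : ∀ {n} → Graph n → Fin n → Fin n → Set
Adj G u v = adj G u v ≡ true

degree : ∀ {n} → Graph n → Fin n → ℕ
degree {n} G v = sum (map (λ u → if adj G v u then 1 else 0) (allFin n))

-- An edge-colouring with colours Fin k (i.e. {1,…,k}): a colour for each
-- ordered adjacent pair, independent of the orientation, i.e. a map on the
-- (unordered) edges.  Values on non-adjacent pairs are irrelevant.
record EdgeColoring {n} (G : Graph n) (k : ℕ) : Set where
  field
    col     : Fin n → Fin n → Fin k
    col-sym : ∀ u v → Adj G u v → col u v ≡ col v u

open EdgeColoring public

-- Injective: for every path with three edges a-b-c-d (a,b,c,d distinct,
-- or a = d so that the path closes into a triangle) the first and third
-- edges receive different colours.  Adjacency already forces a≠b, b≠c, c≠d;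
-- we additionally require a ≠ c and b ≠ d, and allow a = d.
IsInjective : ∀ {n k} {G : Graph n} → EdgeColoring G k → Set
IsInjective {n} {k} {G} c =
  ∀ (a b x d : Fin n) → Adj G a b → Adj G b x → Adj G x d →
    a ≢ x → b ≢ d → col c a b ≢ col c x d

HasInjectiveColoring : ∀ {n} → Graph n → ℕ → Set
HasInjectiveColoring G k = Σ (EdgeColoring G k) IsInjective

-- Colour the edges greedily, one at a time in a fixed linear order.  An edge
-- ab must avoid the colours of the edges xd that end a path a-b-x-d or b-a-x-d;
-- there are at most 2Δ(Δ-1) < 2Δ² ≤ k of them, so a colour is always free.
-- Every path e₁e₂e₃ is then handled when the later of e₁ and e₃ is coloured.
module Submission where

open import Defs
open import Data.Nat using (ℕ; _*_; _≤_; NonZero)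
open import Data.Fin using (Fin)

open import Data.Nat using (zero; suc; _+_; _<_; z≤n; s≤s⁻¹; >-nonZero)
import Data.Nat as ℕ
open import Data.Nat.Properties
  using ( ≤-trans; ≤-<-trans; ≤-reflexive; ≤∧≢⇒<; ≮⇒≥; <⇒≱
        ; +-mono-≤; +-mono-<; *-monoˡ-<; +-identityʳ; module ≤-Reasoning)
open import Data.Nat.ListAction using (sum)
open import Data.Fin using (toℕ; combine; remQuot)
import Data.Fin as Fin
open import Data.Fin.Properties
  using (_≟_; any?; pigeonhole; ≤-total; ≤-antisym; <-cmp; remQuot-combine)
  renaming (<⇒≢ to <⇒≢ᶠ)
open import Data.Bool using (Bool; true; false; if_then_else_; T)
open import Data.List
  using (List; []; _∷_; _++_; map; allFin; filter; filterᵇ; concatMap; length; lookup)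
open import Data.List.Properties using (length-map; length-++; filter-notAll)
open import Data.List.Extrema.Nat using (max; xs≤max; argmax-all)
open import Data.List.Membership.Propositional using (_∈_; _∉_; lose)
open import Data.List.Membership.Propositional.Properties
  using (∈-map⁺; ∈-filter⁺; ∈-allFin; ∈-concatMap⁺; ∈-++⁺ˡ; ∈-++⁺ʳ)
import Data.List.Relation.Unary.All as All
open import Data.List.Relation.Unary.All.Properties using (map⁺; tabulate⁺)
open import Data.List.Relation.Unary.Any using (index)
open import Data.List.Relation.Unary.Any.Properties using (lookup-index)
open import Data.Product using (_×_; _,_; uncurry)
open import Data.Product.Properties using (,-injective)
open import Data.Sum using (_⊎_; inj₁; inj₂)
open import Relation.Nullary using (yes; no; ¬?; contradiction)
open import Relation.Nullary.Decidable using (decidable-stable)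
open import Relation.Binary.Definitions using (tri<; tri≈; tri>)
open import Relation.Binary.PropositionalEquality
  using (_≡_; _≢_; refl; sym; trans; cong; subst; subst₂; ≢-sym; module ≡-Reasoning)

covering-length : ∀ {n} (L : List (Fin n)) → (∀ i → i ∈ L) → n ≤ length L
covering-length L covers = ≮⇒≥ λ short →
  let (i , j , i<j , sameIndex) = pigeonhole short (λ c → index (covers c))
  in <⇒≢ᶠ i<j (trans (lookup-index (covers i))
                 (trans (cong (lookup L) sameIndex) (sym (lookup-index (covers j)))))

module _ {k : ℕ} where
  open import Data.List.Membership.DecPropositional (_≟_ {suc k}) using (_∈?_)

  freshColour : List (Fin (suc k)) → Fin (suc k)
  freshColour L with any? (λ c → ¬? (c ∈? L))
  ... | yes (c , _) = c
  ... | no _        = Fin.zero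

  freshColour-∉ : (L : List (Fin (suc k))) → length L < suc k → freshColour L ∉ L
  freshColour-∉ L short with any? (λ c → ¬? (c ∈? L))
  ... | yes (_ , c∉L) = c∉L
  ... | no noneMissing = contradiction
    (covering-length L (λ c → decidable-stable (c ∈? L) (λ c∉L → noneMissing (c , c∉L))))
    (<⇒≱ short)

module Greedy {N k : ℕ} (conflicts : Fin N → List (Fin N)) where

  -- Items of index below t carry their final colour; the others are still 0.
  colourBelow : ℕ → Fin N → Fin (suc k)
  colourBelow zero    i = Fin.zero
  colourBelow (suc t) i with toℕ i ℕ.≟ t
  ... | yes _ = freshColour (map (colourBelow t) (conflicts i))
  ... | no _  = colourBelow t i

  colour : Fin N → Fin (suc k)
  colour i = freshColour (map (colourBelow (toℕ i)) (conflicts i))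

  colourBelow-stable : ∀ t i → toℕ i < t → colourBelow t i ≡ colour i
  colourBelow-stable (suc t) i i<1+t with toℕ i ℕ.≟ t
  ... | yes refl = refl
  ... | no i≢t   = colourBelow-stable t i (≤∧≢⇒< (s≤s⁻¹ i<1+t) i≢t)

  colour-separates : ∀ {i j} → length (conflicts i) < suc k → j ∈ conflicts i → j Fin.< i →
    colour i ≢ colour j
  colour-separates {i} {j} short j∈ j<i sameColour =
    freshColour-∉ earlier (subst (_< suc k) (sym (length-map _ (conflicts i))) short)
      (subst (_∈ earlier) (trans (colourBelow-stable (toℕ i) j j<i) (sym sameColour))
        (∈-map⁺ (colourBelow (toℕ i)) j∈))
    where
    earlier : List (Fin (suc k))
    earlier = map (colourBelow (toℕ i)) (conflicts i)

length-filterᵇ : ∀ {A : Set} (f : A → Bool) xs →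
  length (filterᵇ f xs) ≡ sum (map (λ x → if f x then 1 else 0) xs)
length-filterᵇ f [] = refl
length-filterᵇ f (x ∷ xs) with f x
... | true  = cong suc (length-filterᵇ f xs)
... | false = length-filterᵇ f xs

length-concatMap-≤ : ∀ {A B : Set} (f : A → List B) {M} → (∀ x → length (f x) ≤ M) →
  ∀ xs → length (concatMap f xs) ≤ length xs * M
length-concatMap-≤ f bound []       = z≤n
length-concatMap-≤ f bound (x ∷ xs) =
  ≤-trans (≤-reflexive (length-++ (f x))) (+-mono-≤ (bound x) (length-concatMap-≤ f bound xs))

module _ {n : ℕ} where

  sortPair : Fin n → Fin n → Fin n × Fin n
  sortPair u v with ≤-total u v
  ... | inj₁ _ = v , u
  ... | inj₂ _ = u , v

  sortPair-comm : ∀ u v → sortPair u v ≡ sortPair v u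
  sortPair-comm u v with ≤-total u v | ≤-total v u
  ... | inj₁ u≤v | inj₁ v≤u rewrite ≤-antisym u≤v v≤u = refl
  ... | inj₁ _   | inj₂ _   = refl
  ... | inj₂ _   | inj₁ _   = refl
  ... | inj₂ v≤u | inj₂ u≤v rewrite ≤-antisym u≤v v≤u = refl

  sortPair-elim : ∀ (P : Fin n × Fin n → Set) u v → P (v , u) → P (u , v) → P (sortPair u v)
  sortPair-elim P u v P[v,u] P[u,v] with ≤-total u v
  ... | inj₁ _ = P[v,u]
  ... | inj₂ _ = P[u,v]

  sortPair-cases : ∀ u v → sortPair u v ≡ (v , u) ⊎ sortPair u v ≡ (u , v)
  sortPair-cases u v = sortPair-elim (λ p → p ≡ (v , u) ⊎ p ≡ (u , v)) u v (inj₁ refl) (inj₂ refl)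

  sortPair-injective : ∀ a b x d → sortPair a b ≡ sortPair x d →
    (a ≡ x × b ≡ d) ⊎ (a ≡ d × b ≡ x)
  sortPair-injective a b x d same with sortPair-cases a b | sortPair-cases x d
  ... | inj₁ p | inj₁ q with refl , refl ← ,-injective (trans (sym p) (trans same q)) = inj₁ (refl , refl)
  ... | inj₁ p | inj₂ q with refl , refl ← ,-injective (trans (sym p) (trans same q)) = inj₂ (refl , refl)
  ... | inj₂ p | inj₁ q with refl , refl ← ,-injective (trans (sym p) (trans same q)) = inj₂ (refl , refl)
  ... | inj₂ p | inj₂ q with refl , refl ← ,-injective (trans (sym p) (trans same q)) = inj₁ (refl , refl)

module _ {n : ℕ} (G : Graph n) where

  Adj-sym : ∀ {u v} → Adj G u v → Adj G v u
  Adj-sym {u} {v} uv = trans (adj-sym G v u) uv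

  Adj⇒≢ : ∀ {u v} → Adj G u v → u ≢ v
  Adj⇒≢ {u} uu refl with () ← trans (sym (adj-irr G u)) uu

  neighbours : Fin n → List (Fin n)
  neighbours v = filterᵇ (adj G v) (allFin n)

  ∈-neighbours : ∀ {u v} → Adj G v u → u ∈ neighbours v
  ∈-neighbours {u} vu = ∈-filter⁺ _ (∈-allFin u) (subst T (sym vu) _)

  length-neighbours : ∀ v → length (neighbours v) ≡ degree G v
  length-neighbours v = length-filterᵇ (adj G v) (allFin n)

  edgeCode : Fin n → Fin n → Fin (n * n)
  edgeCode u v = uncurry combine (sortPair u v)

  edgeCode-comm : ∀ u v → edgeCode u v ≡ edgeCode v u
  edgeCode-comm u v = cong (uncurry combine) (sortPair-comm u v)

  remQuot-edgeCode : ∀ u v → remQuot n (edgeCode u v) ≡ sortPair u v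
  remQuot-edgeCode u v = uncurry remQuot-combine (sortPair u v)

  edgeCode-injective : ∀ a b x d → edgeCode a b ≡ edgeCode x d →
    (a ≡ x × b ≡ d) ⊎ (a ≡ d × b ≡ x)
  edgeCode-injective a b x d same = sortPair-injective a b x d (begin
    sortPair a b             ≡⟨ sym (remQuot-edgeCode a b) ⟩
    remQuot n (edgeCode a b) ≡⟨ cong (remQuot n) same ⟩
    remQuot n (edgeCode x d) ≡⟨ remQuot-edgeCode x d ⟩
    sortPair x d             ∎)
    where open ≡-Reasoning

  otherNeighbours : Fin n → Fin n → List (Fin n)
  otherNeighbours a b = filter (λ x → ¬? (x ≟ a)) (neighbours b)

  incidentEdges : Fin n → List (Fin (n * n))
  incidentEdges x = map (edgeCode x) (neighbours x)

  extensions : Fin n → Fin n → List (Fin (n * n))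
  extensions a b = concatMap incidentEdges (otherNeighbours a b)

  conflictsOf : Fin n × Fin n → List (Fin (n * n))
  conflictsOf (p , q) = extensions p q ++ extensions q p

  edgeConflicts : Fin (n * n) → List (Fin (n * n))
  edgeConflicts i = conflictsOf (remQuot n i)

  ∈-extensions : ∀ {a b x d} → Adj G b x → Adj G x d → a ≢ x → edgeCode x d ∈ extensions a b
  ∈-extensions bx xd a≢x = ∈-concatMap⁺ _
    (lose (∈-filter⁺ (λ x → ¬? (x ≟ _)) (∈-neighbours bx) (≢-sym a≢x)) (∈-map⁺ _ (∈-neighbours xd)))

  ∈-edgeConflicts : ∀ {a b x d} → Adj G b x → Adj G x d → a ≢ x →
    edgeCode x d ∈ edgeConflicts (edgeCode a b)
  ∈-edgeConflicts {a} {b} {x} {d} bx xd a≢x =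
    subst (λ p → edgeCode x d ∈ conflictsOf p) (sym (remQuot-edgeCode a b))
      (sortPair-elim (λ p → edgeCode x d ∈ conflictsOf p) a b
        (∈-++⁺ʳ (extensions b a) (∈-extensions bx xd a≢x))
        (∈-++⁺ˡ (∈-extensions bx xd a≢x)))

  module _ {Δ : ℕ} (degree≤Δ : ∀ v → degree G v ≤ Δ) where
    open ≤-Reasoning

    length-incidentEdges : ∀ x → length (incidentEdges x) ≤ Δ
    length-incidentEdges x = begin
      length (incidentEdges x) ≡⟨ length-map (edgeCode x) (neighbours x) ⟩
      length (neighbours x)    ≡⟨ length-neighbours x ⟩
      degree G x               ≤⟨ degree≤Δ x ⟩
      Δ                        ∎

    length-otherNeighbours : ∀ {a b} → Adj G b a → length (otherNeighbours a b) < Δ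
    length-otherNeighbours {a} {b} ba = begin-strict
      length (otherNeighbours a b) <⟨ filter-notAll _ (neighbours b) (lose (∈-neighbours ba) (λ a≢a → a≢a refl)) ⟩
      length (neighbours b)        ≡⟨ length-neighbours b ⟩
      degree G b                   ≤⟨ degree≤Δ b ⟩
      Δ                            ∎

    length-extensions : ∀ {a b} → Adj G b a → length (extensions a b) < Δ * Δ
    length-extensions {a} {b} ba = begin-strict
      length (extensions a b)             ≤⟨ length-concatMap-≤ incidentEdges length-incidentEdges (otherNeighbours a b) ⟩
      length (otherNeighbours a b) * Δ    <⟨ *-monoˡ-< Δ (length-otherNeighbours ba) ⟩
      Δ * Δ                               ∎
      where
      instance
        Δ-nonZero : NonZero Δ
        Δ-nonZero = >-nonZero (≤-<-trans z≤n (length-otherNeighbours ba))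

    length-conflictsOf : ∀ {p q} → Adj G p q → length (conflictsOf (p , q)) < 2 * (Δ * Δ)
    length-conflictsOf {p} {q} pq = begin-strict
      length (extensions p q ++ extensions q p)         ≡⟨ length-++ (extensions p q) ⟩
      length (extensions p q) + length (extensions q p) <⟨ +-mono-< (length-extensions (Adj-sym pq)) (length-extensions pq) ⟩
      Δ * Δ + Δ * Δ                                     ≡⟨ cong (Δ * Δ +_) (sym (+-identityʳ (Δ * Δ))) ⟩
      2 * (Δ * Δ)                                       ∎

    length-edgeConflicts : ∀ {a b} → Adj G a b → length (edgeConflicts (edgeCode a b)) < 2 * (Δ * Δ)
    length-edgeConflicts {a} {b} ab =
      subst (λ p → length (conflictsOf p) < 2 * (Δ * Δ)) (sym (remQuot-edgeCode a b))
        (sortPair-elim (λ p → length (conflictsOf p) < 2 * (Δ * Δ)) a b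
          (length-conflictsOf (Adj-sym ab)) (length-conflictsOf ab))

  module _ {k Δ : ℕ} (degree≤Δ : ∀ v → degree G v ≤ Δ) (2Δ²≤1+k : 2 * (Δ * Δ) ≤ suc k) where
    open Greedy {k = k} edgeConflicts

    greedyColouring : EdgeColoring G (suc k)
    greedyColouring = record
      { col     = λ u v → colour (edgeCode u v)
      ; col-sym = λ u v _ → cong colour (edgeCode-comm u v)
      }

    later-avoids-earlier : ∀ {a b x d} → Adj G a b → Adj G b x → Adj G x d → a ≢ x →
      edgeCode x d Fin.< edgeCode a b → colour (edgeCode a b) ≢ colour (edgeCode x d)
    later-avoids-earlier ab bx xd a≢x = colour-separates
      (≤-trans (length-edgeConflicts degree≤Δ ab) 2Δ²≤1+k) (∈-edgeConflicts bx xd a≢x)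

    greedyColouring-injective : IsInjective greedyColouring
    greedyColouring-injective a b x d ab bx xd a≢x b≢d with <-cmp (edgeCode x d) (edgeCode a b)
    ... | tri< xd<ab _ _ = later-avoids-earlier ab bx xd a≢x xd<ab
    ... | tri≈ _ sameEdge _ with edgeCode-injective a b x d (sym sameEdge)
    ...   | inj₁ (a≡x , _) = contradiction a≡x a≢x
    ...   | inj₂ (_ , b≡x) = contradiction b≡x (Adj⇒≢ bx)
    greedyColouring-injective a b x d ab bx xd a≢x b≢d | tri> _ _ ab<xd =
      ≢-sym (subst₂ (λ e f → colour e ≢ colour f) (edgeCode-comm d x) (edgeCode-comm b a)
        (later-avoids-earlier (Adj-sym xd) (Adj-sym bx) (Adj-sym ab) (≢-sym b≢d)
          (subst₂ Fin._<_ (edgeCode-comm a b) (edgeCode-comm x d) ab<xd)))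

maxDegree : ∀ {n} → Graph n → ℕ
maxDegree {n} G = max 0 (map (degree G) (allFin n))

degree≤maxDegree : ∀ {n} (G : Graph n) v → degree G v ≤ maxDegree G
degree≤maxDegree G v = All.lookup (xs≤max 0 _) (∈-map⁺ (degree G) (∈-allFin v))

maxDegree-all : ∀ {n} (G : Graph n) (P : ℕ → Set) → P 0 → (∀ v → P (degree G v)) → P (maxDegree G)
maxDegree-all G P P0 Pdeg = argmax-all (λ m → m) {P = P} P0 (map⁺ (tabulate⁺ Pdeg))

mainTheorem6 : (k : ℕ) → .{{_ : NonZero k}} → ∀ {n} (G : Graph n) →
    (∀ (v : Fin n) → 2 * (degree G v * degree G v) ≤ k) →
    HasInjectiveColoring G k
mainTheorem6 (suc k) G 2deg²≤k =
  greedyColouring G degree≤Δ 2Δ²≤k , greedyColouring-injective G degree≤Δ 2Δ²≤k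
  where
  degree≤Δ : ∀ v → degree G v ≤ maxDegree G
  degree≤Δ = degree≤maxDegree G
  2Δ²≤k : 2 * (maxDegree G * maxDegree G) ≤ suc k
  2Δ²≤k = maxDegree-all G (λ m → 2 * (m * m) ≤ suc k) z≤n 2deg²≤k
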